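{- Let $d\ge 3$ and let $y_1,\dots,y_d\ge 2$ be even integers such that $$y_d=y_{d-2}+2y_{d-3}+\cdots+(d-3)y_2+(d-2)y_1=\sum_{i=1}^{d-2}(d-1-i)\,y_i.$$ Then $\chi_{la}(Sp(y_1,\dots,y_d))=d+1$.
   Context: All graphs are finite, simple and connected. For a graph $G=(V,E)$ with $q=|E|$ edges, a local antimagic labeling of $G$ is a bijection $f:E\to\{1,\dots,q\}$ such that $f^+(x)\ne f^+(y)$ for every pair of adjacent vertices $x,y$, where $f^+(x)=\sum_{e\ni x} f(e)$. The local antimagic chromatic number $\chi_{la}(G)$ is the minimum, over all local antimagic labelings $f$ of $G$, of the number of distinct values taken by $f^+$. For $d\ge 3$ and integers $y_1,\dots,y_d\ge 1$, the spider $Sp(y_1,\dots,y_d)$ is the tree obtained from $d$ paths of lengths (numbers of edges) $y_1,\dots,y_d$ by identifying one end-vertex of each path into a single vertex (the core). -}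

module Defs where

open import Data.Nat using (ℕ; zero; suc; _+_; _*_; _∸_; _≤_; _≡ᵇ_)
open import Data.Nat.Properties using (_≟_)
open import Data.Nat.Divisibility using (_∣_)
open import Data.Nat.ListAction using (sum)
open import Data.Bool using (if_then_else_; _∨_)
open import Data.Fin using (Fin; toℕ; fromℕ)
open import Data.List using (List; []; _∷_; _++_; map; length; upTo; deduplicate; allFin; tabulate)
open import Data.List.Membership.Propositional using (_∈_)
open import Data.List.Relation.Binary.Permutation.Propositional using (_↭_)
open import Data.Product using (_×_; _,_; Σ)
open import Data.Sum using (_⊎_)
open import Relation.Binary.PropositionalEquality using (_≡_; _≢_)

-- A finite graph: vertices are 0 … n-1, edges are a list of (unordered) pairs.
record Graph : Set where
  field
    n     : ℕ
    edges : List (ℕ × ℕ)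
open Graph public

numEdges : Graph → ℕ
numEdges G = length (edges G)

Adjacent : Graph → ℕ → ℕ → Set
Adjacent G x y = ((x , y) ∈ edges G) ⊎ ((y , x) ∈ edges G)

-- A labeling lists the label of each edge (positionally, same order as 'edges').
-- It is a bijection onto {1,…,q} iff the label list is a permutation of [1,…,q].
IsBijLabeling : Graph → List ℕ → Set
IsBijLabeling G labs = labs ↭ map suc (upTo (numEdges G))

vsum' : List (ℕ × ℕ) → List ℕ → ℕ → ℕ
vsum' ((u , v) ∷ es) (l ∷ ls) x = (if (u ≡ᵇ x) ∨ (v ≡ᵇ x) then l else 0) + vsum' es ls x
vsum' _ _ _ = 0

vsum : Graph → List ℕ → ℕ → ℕ
vsum G labs x = vsum' (edges G) labs x

IsLocalAntimagic : Graph → List ℕ → Set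
IsLocalAntimagic G labs =
  IsBijLabeling G labs × (∀ x y → x Data.Nat.< n G → y Data.Nat.< n G → Adjacent G x y → vsum G labs x ≢ vsum G labs y)

numColors : Graph → List ℕ → ℕ
numColors G labs = length (deduplicate _≟_ (map (vsum G labs) (upTo (n G))))

ChiLaIs : Graph → ℕ → Set
ChiLaIs G k =
  Σ (List ℕ) (λ labs → IsLocalAntimagic G labs × numColors G labs ≡ k)
  × (∀ labs → IsLocalAntimagic G labs → k ≤ numColors G labs)

-- path hanging at vertex u, new vertices numbered s, s+1, …, s+y-1
pathEdges : ℕ → ℕ → ℕ → List (ℕ × ℕ)
pathEdges u s zero    = []
pathEdges u s (suc y) = (u , s) ∷ pathEdges s (suc s) y

legsEdges : ℕ → List ℕ → List (ℕ × ℕ)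
legsEdges s []       = []
legsEdges s (y ∷ ys) = pathEdges 0 s y ++ legsEdges (s + y) ys

-- Spider Sp(y_1,…,y_d) with y_{i+1} = y i for i : Fin d; core = vertex 0
Spider : (d : ℕ) → (Fin d → ℕ) → Graph
Spider d y = record { n = suc (sum (tabulate y)) ; edges = legsEdges 1 (tabulate y) }

module Submission where

-- Lower bound: under a bijective labelling the leaf of a leg carries the label of its pendant edge,
-- which is smaller than the sum at its neighbour. The d leaf sums are distinct labels, and the
-- neighbour of the leaf with the largest sum adds a (d+1)-st value.
-- Upper bound: write y_i = 2k_i, Q = Σ k_i, q = 2Q and P_i = k_1 + ⋯ + k_(i-1), and label leg i
-- outward from the core by P_i+k_i, q+1-(P_i+k_i), P_i+k_i-1, …, P_i+1, q+1-(P_i+1). The inner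
-- sums alternate between q+1 and q, the leaf of leg i gets q-P_i, and the core gets
-- Σ_i (P_i+k_i) = Σ_i (d+1-i) k_i, which the hypothesis on y_d makes equal to q = q-P_1.
-- So only the d+1 values q+1, q-P_1, …, q-P_d occur.

open import Defs
open import Data.Bool using (true; false; if_then_else_; _∨_)
open import Data.Bool.Properties using (∨-zeroʳ)
open import Data.Empty using (⊥-elim)
open import Data.Fin using (Fin; toℕ; fromℕ; inject₁)
import Data.Fin as Fin
open import Data.List using (List; []; _∷_; _∷ʳ_; _++_; map; length; upTo; deduplicate; take; drop; tabulate; allFin)
open import Data.List.Properties
  using (length-++; length-drop; length-map; length-upTo; length-tabulate; map-cong-local; map-tabulate;
         tabulate-cong; take++drop≡id)
open import Data.List.Extrema.Nat using (argmax; argmax-all; f[⊥]≤f[argmax]; f[xs]≤f[argmax])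
open import Data.List.Membership.Propositional using (_∈_)
open import Data.List.Membership.Propositional.Properties
  using (∈-∃++; ∈-++⁻; ∈-++⁺ˡ; ∈-++⁺ʳ; ∈-map⁺; ∈-map⁻; ∈-upTo⁺; ∈-upTo⁻;
         ∈-deduplicate⁺; ∈-deduplicate⁻)
open import Data.List.Membership.Propositional.Properties.WithK using (unique∧set⇒bag)
open import Data.List.Relation.Binary.BagAndSetEquality using (∼bag⇒↭)
open import Data.List.Relation.Binary.Permutation.Propositional using (_↭_; ↭-sym; ↭⇒↭ₛ)
open import Data.List.Relation.Binary.Permutation.Propositional.Properties using (∈-resp-↭; ↭-length)
open import Data.List.Relation.Binary.Subset.Propositional using (_⊆_)
open import Data.List.Relation.Unary.Any using (here; there)
open import Data.List.Relation.Unary.All as All using (All; []; _∷_)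
open import Data.List.Relation.Unary.All.Properties as All using (¬Any⇒All¬)
open import Data.List.Relation.Unary.Unique.Propositional using (Unique; []; _∷_)
import Data.List.Relation.Unary.Unique.Propositional.Properties as Unique
open import Data.Nat using (ℕ; zero; suc; pred; _+_; _*_; _∸_; _≤_; _<_; _≡ᵇ_; z≤n; s≤s)
open import Data.Nat.Divisibility using (_∣_; divides)
open import Data.Nat.ListAction using (sum)
open import Data.Nat.Properties
open import Data.Nat.Tactic.RingSolver using (solve-∀)
open import Data.Product using (_×_; _,_; Σ; ∃; proj₁)
open import Data.Sum using (_⊎_; inj₁; inj₂)
open import Function using (_∘_; id; case_of_)
open import Function.Bundles using (mk⇔)
open import Relation.Nullary using (¬_; contradiction; yes; no)
open import Relation.Binary.PropositionalEquality
open import Data.List.Membership.DecPropositional _≟_ using (_∈?_)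
open import Data.List.Relation.Unary.Unique.DecPropositional.Properties _≟_ using (deduplicate-!)
open import Data.List.Relation.Binary.Permutation.Setoid.Properties (setoid ℕ) using (Unique-resp-↭)


module _ {a} {A : Set a} where

  unique-⊆⇒length≤ : {xs ys : List A} → Unique xs → xs ⊆ ys → length xs ≤ length ys
  unique-⊆⇒length≤ [] _ = z≤n
  unique-⊆⇒length≤ {x ∷ xs} (x∉xs ∷ xs!) xs⊆ys with ∈-∃++ (xs⊆ys (here refl))
  ... | as , bs , refl = begin
    suc (length xs)              ≤⟨ s≤s (unique-⊆⇒length≤ xs! xs⊆as++bs) ⟩
    suc (length (as ++ bs))      ≡⟨ cong suc (length-++ as) ⟩
    suc (length as + length bs)  ≡⟨ +-suc (length as) (length bs) ⟨
    length as + length (x ∷ bs)  ≡⟨ length-++ as ⟨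
    length (as ++ x ∷ bs)        ∎
    where
    open ≤-Reasoning
    xs⊆as++bs : xs ⊆ as ++ bs
    xs⊆as++bs z∈xs with ∈-++⁻ as (xs⊆ys (there z∈xs))
    ... | inj₁ z∈as         = ∈-++⁺ˡ z∈as
    ... | inj₂ (here refl)  = ⊥-elim (All.lookup x∉xs z∈xs refl)
    ... | inj₂ (there z∈bs) = ∈-++⁺ʳ as z∈bs

  take-++ : ∀ (xs ys : List A) {n} → length xs ≡ n → take n (xs ++ ys) ≡ xs
  take-++ []       ys refl = refl
  take-++ (x ∷ xs) ys refl = cong (x ∷_) (take-++ xs ys refl)

  drop-++ : ∀ (xs ys : List A) {n} → length xs ≡ n → drop n (xs ++ ys) ≡ ys
  drop-++ []       ys refl = refl
  drop-++ (x ∷ xs) ys refl = drop-++ xs ys refl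

  ∈-take⇒∈ : ∀ {x} y (ls : List A) → x ∈ take y ls → x ∈ ls
  ∈-take⇒∈ {x} y ls p = subst (x ∈_) (take++drop≡id y ls) (∈-++⁺ˡ p)

  ∈-drop⇒∈ : ∀ {x} y (ls : List A) → x ∈ drop y ls → x ∈ ls
  ∈-drop⇒∈ {x} y ls p = subst (x ∈_) (take++drop≡id y ls) (∈-++⁺ʳ (take y ls) p)

  unique-++⇒≢ : ∀ xs {ys : List A} {a b} → Unique (xs ++ ys) → a ∈ xs → b ∈ ys → a ≢ b
  unique-++⇒≢ (x ∷ xs) (x∉ ∷ _)  (here refl) b∈ys = All.lookup x∉ (∈-++⁺ʳ xs b∈ys)
  unique-++⇒≢ (x ∷ xs) (_ ∷ xs!) (there a∈xs) b∈ys = unique-++⇒≢ xs xs! a∈xs b∈ys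

unique-⊆-length≥⇒⊇ : {xs ys : List ℕ} → Unique xs → xs ⊆ ys → length ys ≤ length xs → ys ⊆ xs
unique-⊆-length≥⇒⊇ {xs} {ys} xs! xs⊆ys ys≤xs {z} z∈ys with z ∈? xs
... | yes z∈xs = z∈xs
... | no  z∉xs =
  ⊥-elim (<-irrefl refl (≤-trans (unique-⊆⇒length≤ (¬Any⇒All¬ xs z∉xs ∷ xs!) z∷xs⊆ys) ys≤xs))
  where
  z∷xs⊆ys : z ∷ xs ⊆ ys
  z∷xs⊆ys (here refl) = z∈ys
  z∷xs⊆ys (there w∈xs) = xs⊆ys w∈xs

unique-⊆⇒↭ : {xs ys : List ℕ} → Unique xs → Unique ys → xs ⊆ ys → length ys ≤ length xs → xs ↭ ys
unique-⊆⇒↭ xs! ys! xs⊆ys ys≤xs =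
  ∼bag⇒↭ (unique∧set⇒bag xs! ys! (mk⇔ xs⊆ys (unique-⊆-length≥⇒⊇ xs! xs⊆ys ys≤xs)))

spider : List ℕ → Graph
spider ys = record { n = suc (sum ys) ; edges = legsEdges 1 ys }

≡ᵇ-refl : ∀ n → (n ≡ᵇ n) ≡ true
≡ᵇ-refl zero    = refl
≡ᵇ-refl (suc n) = ≡ᵇ-refl n

≢⇒≡ᵇ-false : ∀ {m n} → m ≢ n → (m ≡ᵇ n) ≡ false
≢⇒≡ᵇ-false {zero}  {zero}  m≢n = contradiction refl m≢n
≢⇒≡ᵇ-false {zero}  {suc n} _   = refl
≢⇒≡ᵇ-false {suc m} {zero}  _   = refl
≢⇒≡ᵇ-false {suc m} {suc n} m≢n = ≢⇒≡ᵇ-false (m≢n ∘ cong suc)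

vsum'-[] : ∀ es x → vsum' es [] x ≡ 0
vsum'-[] []      x = refl
vsum'-[] (_ ∷ _) x = refl

vsum'-++ : ∀ es₁ es₂ ls x →
  vsum' (es₁ ++ es₂) ls x ≡ vsum' es₁ ls x + vsum' es₂ (drop (length es₁) ls) x
vsum'-++ []              es₂ ls       x = refl
vsum'-++ (_ ∷ es₁)       es₂ []       x = sym (vsum'-[] es₂ x)
vsum'-++ ((u , v) ∷ es₁) es₂ (l ∷ ls) x =
  trans (cong (c +_) (vsum'-++ es₁ es₂ ls x)) (sym (+-assoc c _ _))
  where c = if (u ≡ᵇ x) ∨ (v ≡ᵇ x) then l else 0

labelAt : List ℕ → ℕ → ℕ
labelAt []       _       = 0
labelAt (l ∷ _)  zero    = l
labelAt (_ ∷ ls) (suc j) = labelAt ls j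

pathSum : List ℕ → ℕ → ℕ
pathSum ls j = labelAt ls j + labelAt ls (suc j)

length-pathEdges : ∀ u s y → length (pathEdges u s y) ≡ y
length-pathEdges u s zero    = refl
length-pathEdges u s (suc y) = cong suc (length-pathEdges s (suc s) y)

outside-path⇒≢ : ∀ {s y x} → x < s ⊎ s + suc y ≤ x → x ≢ s
outside-path⇒≢ (inj₁ x<s)     refl = <-irrefl refl x<s
outside-path⇒≢ (inj₂ s+1+y≤x) refl = <-irrefl refl (<-≤-trans (m<m+n _ (s≤s z≤n)) s+1+y≤x)

vsum-pathEdges-outside : ∀ u s y ls x → x ≢ u → x < s ⊎ s + y ≤ x → vsum' (pathEdges u s y) ls x ≡ 0
vsum-pathEdges-outside u s zero    ls       x _   _       = refl
vsum-pathEdges-outside u s (suc y) []       x _   _       = refl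
vsum-pathEdges-outside u s (suc y) (l ∷ ls) x x≢u outside
  rewrite ≢⇒≡ᵇ-false (x≢u ∘ sym) | ≢⇒≡ᵇ-false (outside-path⇒≢ outside ∘ sym)
  = vsum-pathEdges-outside s (suc s) y ls x (outside-path⇒≢ outside) (shift outside)
  where
  shift : x < s ⊎ s + suc y ≤ x → x < suc s ⊎ suc s + y ≤ x
  shift (inj₁ x<s)   = inj₁ (m<n⇒m<1+n x<s)
  shift (inj₂ s+y<x) = inj₂ (subst (_≤ x) (+-suc s y) s+y<x)

vsum-pathEdges-root : ∀ u s y ls → u < s → vsum' (pathEdges u s y) ls u ≡ labelAt (take y ls) 0
vsum-pathEdges-root u s zero    ls       _   = refl
vsum-pathEdges-root u s (suc y) []       _   = refl
vsum-pathEdges-root u s (suc y) (l ∷ ls) u<s rewrite ≡ᵇ-refl u =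
  trans (cong (l +_) (vsum-pathEdges-outside s (suc s) y ls u (<⇒≢ u<s) (inj₁ (m<n⇒m<1+n u<s))))
        (+-identityʳ l)

vsum-pathEdges-inner : ∀ u s y ls j → u < s → vsum' (pathEdges u s y) ls (s + j) ≡ pathSum (take y ls) j
vsum-pathEdges-inner u s zero    ls       j       _   = refl
vsum-pathEdges-inner u s (suc y) []       j       _   = refl
vsum-pathEdges-inner u s (suc y) (l ∷ ls) zero    _
  rewrite +-identityʳ s | ≡ᵇ-refl s | ∨-zeroʳ (u ≡ᵇ s)
  = cong (l +_) (vsum-pathEdges-root s (suc s) y ls (n<1+n s))
vsum-pathEdges-inner u s (suc y) (l ∷ ls) (suc j) u<s
  rewrite ≢⇒≡ᵇ-false (<⇒≢ (<-≤-trans u<s (m≤m+n s (suc j))))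
        | ≢⇒≡ᵇ-false (<⇒≢ (m<m+n s (s≤s (z≤n {j}))))
        | +-suc s j
  = vsum-pathEdges-inner s (suc s) y ls j (n<1+n s)

pathEdges-∈ : ∀ u s y {a b} → (a , b) ∈ pathEdges u s y →
  (a ≡ u × b ≡ s × 0 < y) ⊎ ∃ λ j → suc j < y × a ≡ s + j × b ≡ suc a
pathEdges-∈ u s (suc y) (here refl) = inj₁ (refl , refl , s≤s z≤n)
pathEdges-∈ u s (suc y) (there e∈) with pathEdges-∈ s (suc s) y e∈
... | inj₁ (refl , refl , 0<y)       = inj₂ (0 , s≤s 0<y , sym (+-identityʳ s) , refl)
... | inj₂ (j , 1+j<y , refl , refl) = inj₂ (suc j , s≤s 1+j<y , sym (+-suc s j) , refl)

length-legsEdges : ∀ s ys → length (legsEdges s ys) ≡ sum ys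
length-legsEdges s []       = refl
length-legsEdges s (y ∷ ys) =
  trans (length-++ (pathEdges 0 s y)) (cong₂ _+_ (length-pathEdges 0 s y) (length-legsEdges (s + y) ys))

vsum-legsEdges-∷ : ∀ s y ys ls x → vsum' (legsEdges s (y ∷ ys)) ls x
  ≡ vsum' (pathEdges 0 s y) ls x + vsum' (legsEdges (s + y) ys) (drop y ls) x
vsum-legsEdges-∷ s y ys ls x =
  trans (vsum'-++ (pathEdges 0 s y) (legsEdges (s + y) ys) ls x)
        (cong (λ n → vsum' (pathEdges 0 s y) ls x + vsum' (legsEdges (s + y) ys) (drop n ls) x)
              (length-pathEdges 0 s y))

vsum-legsEdges-below : ∀ s ys ls x → x ≢ 0 → x < s → vsum' (legsEdges s ys) ls x ≡ 0
vsum-legsEdges-below s []       ls x _   _   = refl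
vsum-legsEdges-below s (y ∷ ys) ls x x≢0 x<s =
  trans (vsum-legsEdges-∷ s y ys ls x)
        (cong₂ _+_ (vsum-pathEdges-outside 0 s y ls x x≢0 (inj₁ x<s))
                   (vsum-legsEdges-below (s + y) ys (drop y ls) x x≢0 (<-≤-trans x<s (m≤m+n s y))))

coreSum : List ℕ → List ℕ → ℕ
coreSum []       ls = 0
coreSum (y ∷ ys) ls = labelAt (take y ls) 0 + coreSum ys (drop y ls)

vsum-legsEdges-core : ∀ s ys ls → 0 < s → vsum' (legsEdges s ys) ls 0 ≡ coreSum ys ls
vsum-legsEdges-core s []       ls _   = refl
vsum-legsEdges-core s (y ∷ ys) ls 0<s =
  trans (vsum-legsEdges-∷ s y ys ls 0)
        (cong₂ _+_ (vsum-pathEdges-root 0 s y ls 0<s)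
                   (vsum-legsEdges-core (s + y) ys (drop y ls) (<-≤-trans 0<s (m≤m+n s y))))

vsum-legsEdges-first : ∀ s y ys ls j → 0 < s → j < y →
  vsum' (legsEdges s (y ∷ ys)) ls (s + j) ≡ pathSum (take y ls) j
vsum-legsEdges-first s y ys ls j 0<s j<y = begin
  vsum' (legsEdges s (y ∷ ys)) ls (s + j)
    ≡⟨ vsum-legsEdges-∷ s y ys ls (s + j) ⟩
  vsum' (pathEdges 0 s y) ls (s + j) + vsum' (legsEdges (s + y) ys) (drop y ls) (s + j)
    ≡⟨ cong₂ _+_ (vsum-pathEdges-inner 0 s y ls j 0<s)
                 (vsum-legsEdges-below (s + y) ys (drop y ls) (s + j) s+j≢0 (+-monoʳ-< s j<y)) ⟩
  pathSum (take y ls) j + 0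
    ≡⟨ +-identityʳ _ ⟩
  pathSum (take y ls) j ∎
  where
  open ≡-Reasoning
  s+j≢0 : s + j ≢ 0
  s+j≢0 = >⇒≢ (<-≤-trans 0<s (m≤m+n s j))

vsum-legsEdges-later : ∀ s y ys ls x → 0 < s → s + y ≤ x →
  vsum' (legsEdges s (y ∷ ys)) ls x ≡ vsum' (legsEdges (s + y) ys) (drop y ls) x
vsum-legsEdges-later s y ys ls x 0<s s+y≤x =
  trans (vsum-legsEdges-∷ s y ys ls x)
        (cong (_+ vsum' (legsEdges (s + y) ys) (drop y ls) x)
              (vsum-pathEdges-outside 0 s y ls x x≢0 (inj₂ s+y≤x)))
  where
  x≢0 : x ≢ 0
  x≢0 = >⇒≢ (<-≤-trans 0<s (≤-trans (m≤m+n s y) s+y≤x))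

labelAt-take-≥ : ∀ ls {y j} → y ≤ j → labelAt (take y ls) j ≡ 0
labelAt-take-≥ []       {zero}          _         = refl
labelAt-take-≥ []       {suc y}         _         = refl
labelAt-take-≥ (l ∷ ls) {zero}          _         = refl
labelAt-take-≥ (l ∷ ls) {suc y} {suc j} (s≤s y≤j) = labelAt-take-≥ ls y≤j

labelAt-take-∈ : ∀ ls {y j} → j < y → j < length ls → labelAt (take y ls) j ∈ take y ls
labelAt-take-∈ (l ∷ ls) {suc y} {zero}  _         _         = here refl
labelAt-take-∈ (l ∷ ls) {suc y} {suc j} (s≤s j<y) (s≤s j<l) = there (labelAt-take-∈ ls j<y j<l)

leaves : ℕ → List ℕ → List ℕ
leaves s []       = []
leaves s (y ∷ ys) = s + pred y ∷ leaves (s + y) ys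

length-leaves : ∀ s ys → length (leaves s ys) ≡ length ys
length-leaves s []       = refl
length-leaves s (y ∷ ys) = cong suc (length-leaves (s + y) ys)

-- x is the leaf of one of the legs with vertices in (s, t); pred x is its neighbour on that leg.
record Pendant (F : ℕ → ℕ) (ls : List ℕ) (s t x : ℕ) : Set where
  constructor pendant
  field
    after     : s < x
    before    : x < t
    descends  : F x < F (pred x)
    isLabel   : F x ∈ ls

pendant-first : ∀ s y ys ls → 0 < s → 2 ≤ y → y ≤ length ls → All (1 ≤_) ls →
  Pendant (vsum' (legsEdges s (y ∷ ys)) ls) (take y ls) s (s + y) (s + pred y)
pendant-first s y@(suc (suc y')) ys ls 0<s (s≤s (s≤s z≤n)) y≤ls ls≥1 =
  pendant (m<m+n s (s≤s z≤n)) (+-monoʳ-< s (n<1+n (suc y'))) leaf<pred (subst (_∈ take y ls) (sym leaf≡last) last∈)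
  where
  F = vsum' (legsEdges s (y ∷ ys)) ls
  last = labelAt (take y ls) (suc y')
  prev = labelAt (take y ls) y'
  last∈ : last ∈ take y ls
  last∈ = labelAt-take-∈ ls (n<1+n (suc y')) y≤ls
  prev∈ : prev ∈ take y ls
  prev∈ = labelAt-take-∈ ls (m<n⇒m<1+n (n<1+n y')) (<-trans (n<1+n y') y≤ls)
  leaf≡last : F (s + suc y') ≡ last
  leaf≡last = begin
    F (s + suc y')              ≡⟨ vsum-legsEdges-first s y ys ls (suc y') 0<s (n<1+n (suc y')) ⟩
    last + labelAt (take y ls) y ≡⟨ cong (last +_) (labelAt-take-≥ ls (≤-refl {y})) ⟩
    last + 0                    ≡⟨ +-identityʳ last ⟩
    last                        ∎
    where open ≡-Reasoning
  pred≡prev+last : F (pred (s + suc y')) ≡ prev + last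
  pred≡prev+last = trans (cong (F ∘ pred) (+-suc s y'))
                         (vsum-legsEdges-first s y ys ls y' 0<s (m<n⇒m<1+n (n<1+n y')))
  leaf<pred : F (s + suc y') < F (pred (s + suc y'))
  leaf<pred = subst₂ _<_ (sym leaf≡last) (sym pred≡prev+last)
                     (m<n+m last (All.lookup ls≥1 (∈-take⇒∈ y ls prev∈)))

pendant-weaken : ∀ {F ls ls' s t t' x} → t ≤ t' → ls ⊆ ls' → Pendant F ls s t x → Pendant F ls' s t' x
pendant-weaken t≤t' ls⊆ls' (pendant s<x x<t Fx<Fpx Fx∈ls) = pendant s<x (<-≤-trans x<t t≤t') Fx<Fpx (ls⊆ls' Fx∈ls)

pendant-later : ∀ s y ys ls x → 0 < s →
  Pendant (vsum' (legsEdges (s + y) ys) (drop y ls)) (drop y ls) (s + y) (s + y + sum ys) x →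
  Pendant (vsum' (legsEdges s (y ∷ ys)) ls) ls s (s + sum (y ∷ ys)) x
pendant-later s y ys ls x 0<s (pendant s+y<x x<t Fx<Fpx Fx∈) = pendant
  (≤-<-trans (m≤m+n s y) s+y<x)
  (subst (x <_) (+-assoc s y (sum ys)) x<t)
  (subst₂ _<_ (sym (later x (<⇒≤ s+y<x))) (sym (later (pred x) (<⇒≤pred s+y<x))) Fx<Fpx)
  (subst (_∈ ls) (sym (later x (<⇒≤ s+y<x))) (∈-drop⇒∈ y ls Fx∈))
  where
  later : ∀ z → s + y ≤ z → vsum' (legsEdges s (y ∷ ys)) ls z ≡ vsum' (legsEdges (s + y) ys) (drop y ls) z
  later z = vsum-legsEdges-later s y ys ls z 0<s

length-drop-sum : ∀ y ys (ls : List ℕ) → length ls ≡ y + sum ys → length (drop y ls) ≡ sum ys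
length-drop-sum y ys ls ls≡ = trans (length-drop y ls) (trans (cong (_∸ y) ls≡) (m+n∸m≡n y (sum ys)))

leaves-pendant : ∀ s ys ls → 0 < s → All (2 ≤_) ys → length ls ≡ sum ys → All (1 ≤_) ls →
  All (Pendant (vsum' (legsEdges s ys) ls) ls s (s + sum ys)) (leaves s ys)
leaves-pendant s []       ls _   _               _   _    = []
leaves-pendant s (y ∷ ys) ls 0<s (y≥2 ∷ ys≥2) ls≡ ls≥1 =
  pendant-weaken {F = vsum' (legsEdges s (y ∷ ys)) ls} (+-monoʳ-≤ s (m≤m+n y (sum ys))) (∈-take⇒∈ y ls)
                 (pendant-first s y ys ls 0<s y≥2 (subst (y ≤_) (sym ls≡) (m≤m+n y (sum ys))) ls≥1)
  ∷ All.map (pendant-later s y ys ls _ 0<s)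
      (leaves-pendant (s + y) ys (drop y ls) (<-≤-trans 0<s (m≤m+n s y)) ys≥2
                      (length-drop-sum y ys ls ls≡) (All.drop⁺ y ls≥1))

leaves-unique : ∀ s ys ls → 0 < s → All (2 ≤_) ys → length ls ≡ sum ys → All (1 ≤_) ls → Unique ls →
  Unique (map (vsum' (legsEdges s ys) ls) (leaves s ys))
leaves-unique s []       ls _   _            _   _    _   = []
leaves-unique s (y ∷ ys) ls 0<s (y≥2 ∷ ys≥2) ls≡ ls≥1 ls! =
  All.map⁺ head∉tail ∷ subst Unique (sym tail≡)
    (leaves-unique (s + y) ys (drop y ls) 0<s+y ys≥2 ls'≡ (All.drop⁺ y ls≥1) (Unique.drop⁺ y ls!))
  where
  F  = vsum' (legsEdges s (y ∷ ys)) ls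
  F' = vsum' (legsEdges (s + y) ys) (drop y ls)
  0<s+y : 0 < s + y
  0<s+y = <-≤-trans 0<s (m≤m+n s y)
  ls'≡ : length (drop y ls) ≡ sum ys
  ls'≡ = length-drop-sum y ys ls ls≡
  later : ∀ {x} → Pendant F' (drop y ls) (s + y) (s + y + sum ys) x → F x ≡ F' x
  later {x} p = vsum-legsEdges-later s y ys ls x 0<s (<⇒≤ (Pendant.after p))
  tail-pendants : All (Pendant F' (drop y ls) (s + y) (s + y + sum ys)) (leaves (s + y) ys)
  tail-pendants = leaves-pendant (s + y) ys (drop y ls) 0<s+y ys≥2 ls'≡ (All.drop⁺ y ls≥1)
  tail≡ : map F (leaves (s + y) ys) ≡ map F' (leaves (s + y) ys)
  tail≡ = map-cong-local (All.map later tail-pendants)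
  head∈ : F (s + pred y) ∈ take y ls
  head∈ = Pendant.isLabel (pendant-first s y ys ls 0<s y≥2 (subst (y ≤_) (sym ls≡) (m≤m+n y (sum ys))) ls≥1)
  head∉tail : All (λ x → F (s + pred y) ≢ F x) (leaves (s + y) ys)
  head∉tail = All.map (λ p eq →
    unique-++⇒≢ (take y ls) (subst Unique (sym (take++drop≡id y ls)) ls!) head∈ (Pendant.isLabel p)
                (trans eq (later p)))
    tail-pendants

module _ {labs : List ℕ} {q : ℕ} (bij : labs ↭ map suc (upTo q)) where

  bijection-unique : Unique labs
  bijection-unique = Unique-resp-↭ (↭⇒↭ₛ (↭-sym bij)) (Unique.map⁺ suc-injective (Unique.upTo⁺ q))

  bijection-positive : All (1 ≤_) labs
  bijection-positive = All.tabulate λ l∈labs → positive (∈-map⁻ suc (∈-resp-↭ bij l∈labs))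
    where
    positive : ∀ {l} → ∃ (λ i → i ∈ upTo q × l ≡ suc i) → 1 ≤ l
    positive (_ , _ , refl) = s≤s z≤n

  bijection-length : length labs ≡ q
  bijection-length = trans (↭-length bij) (trans (length-map suc (upTo q)) (length-upTo q))

vsum∈colours : ∀ G labs {x} → x < n G → vsum G labs x ∈ deduplicate _≟_ (map (vsum G labs) (upTo (n G)))
vsum∈colours G labs x<n = ∈-deduplicate⁺ _≟_ (∈-map⁺ (vsum G labs) (∈-upTo⁺ x<n))

spider-numColors≥ : ∀ ys labs → All (2 ≤_) ys → ys ≢ [] → IsBijLabeling (spider ys) labs →
  suc (length ys) ≤ numColors (spider ys) labs
spider-numColors≥ []           labs _    []≢[] _   = contradiction refl []≢[]
spider-numColors≥ ys@(y ∷ ys') labs ys≥2 _     bij =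
  subst (_≤ numColors (spider ys) labs) |D|≡ (unique-⊆⇒length≤ D! D⊆colours)
  where
  F = vsum (spider ys) labs
  ls≡ : length labs ≡ sum ys
  ls≡ = trans (bijection-length bij) (length-legsEdges 1 ys)
  pendants : All (Pendant F labs 1 (suc (sum ys))) (leaves 1 ys)
  pendants = leaves-pendant 1 ys labs (s≤s z≤n) ys≥2 ls≡ (bijection-positive bij)
  x₀ = 1 + pred y
  xs = leaves (1 + y) ys'
  w = argmax F x₀ xs
  w-pendant : Pendant F labs 1 (suc (sum ys)) w
  w-pendant = argmax-all F (All.head pendants) (All.tail pendants)
  Fw-max : All (λ x → F x ≤ F w) (leaves 1 ys)
  Fw-max = f[⊥]≤f[argmax] {f = F} x₀ xs ∷ f[xs]≤f[argmax] {f = F} x₀ xs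
  D = F (pred w) ∷ map F (leaves 1 ys)
  D! : Unique D
  D! = All.map⁺ (All.map (λ Fx≤Fw → >⇒≢ (≤-<-trans Fx≤Fw (Pendant.descends w-pendant))) Fw-max)
       ∷ leaves-unique 1 ys labs (s≤s z≤n) ys≥2 ls≡ (bijection-positive bij) (bijection-unique bij)
  D⊆colours : D ⊆ deduplicate _≟_ (map F (upTo (suc (sum ys))))
  D⊆colours (here refl) = vsum∈colours (spider ys) labs (≤-<-trans pred[n]≤n (Pendant.before w-pendant))
  D⊆colours (there v∈) with ∈-map⁻ F v∈
  ... | x , x∈leaves , refl = vsum∈colours (spider ys) labs (Pendant.before (All.lookup pendants x∈leaves))
  |D|≡ : length D ≡ suc (length ys)
  |D|≡ = cong suc (trans (length-map F (leaves 1 ys)) (length-leaves 1 ys))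

double : ℕ → ℕ
double zero    = 0
double (suc k) = suc (suc (double k))

double≡+ : ∀ n → double n ≡ n + n
double≡+ zero    = refl
double≡+ (suc n) = cong suc (trans (cong suc (double≡+ n)) (sym (+-suc n n)))

sum-map-double : ∀ ks → sum (map double ks) ≡ double (sum ks)
sum-map-double []       = refl
sum-map-double (k ∷ ks) = trans (cong (double k +_) (sum-map-double ks)) (double-+ k (sum ks))
  where
  double-+ : ∀ m n → double m + double n ≡ double (m + n)
  double-+ zero    n = refl
  double-+ (suc m) n = cong (suc ∘ suc) (double-+ m n)

weighted : ℕ → List ℕ → ℕ
weighted c []       = 0
weighted c (x ∷ xs) = c * x + weighted (c ∸ 1) xs

leg-or-beyond : ∀ {s x} y → s ≤ x → (∃ λ j → j < y × x ≡ s + j) ⊎ s + y ≤ x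
leg-or-beyond {s} {x} y s≤x with x <? s + y
... | yes x<s+y = inj₁ (x ∸ s , subst (x ∸ s <_) (m+n∸m≡n s y) (∸-monoˡ-< x<s+y s≤x) , sym (m+[n∸m]≡n s≤x))
... | no  x≮s+y = inj₂ (≮⇒≥ x≮s+y)

module Construction (Q : ℕ) where

  q : ℕ
  q = double Q

  mirror : ℕ → ℕ
  mirror z = suc q ∸ z

  legLabels : ℕ → ℕ → List ℕ
  legLabels P zero    = []
  legLabels P (suc k) = P + suc k ∷ mirror (P + suc k) ∷ legLabels P k

  spiderLabels : ℕ → List ℕ → List ℕ
  spiderLabels P []       = []
  spiderLabels P (k ∷ ks) = legLabels P k ++ spiderLabels (P + k) ks

  legOffsets : ℕ → List ℕ → List ℕ
  legOffsets P []       = []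
  legOffsets P (k ∷ ks) = P ∷ legOffsets (P + k) ks

  length-legOffsets : ∀ P ks → length (legOffsets P ks) ≡ length ks
  length-legOffsets P []       = refl
  length-legOffsets P (k ∷ ks) = cong suc (length-legOffsets (P + k) ks)

  legSum : ℕ → ℕ → ℕ → ℕ
  legSum P zero          j             = 0
  legSum P (suc k)       zero          = suc q
  legSum P (suc k)       (suc (suc j)) = legSum P k j
  legSum P (suc zero)    (suc zero)    = q ∸ P
  legSum P (suc (suc k)) (suc zero)    = q

  length-legLabels : ∀ P k → length (legLabels P k) ≡ double k
  length-legLabels P zero    = refl
  length-legLabels P (suc k) = cong (suc ∘ suc) (length-legLabels P k)

  pathSum-legLabels : ∀ P k j → P + k ≤ q → pathSum (legLabels P k) j ≡ legSum P k j
  pathSum-legLabels P zero          j             _      = refl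
  pathSum-legLabels P (suc k)       zero          P+k≤q  = m+[n∸m]≡n (m≤n⇒m≤1+n P+k≤q)
  pathSum-legLabels P (suc zero)    (suc zero)    _      =
    trans (+-identityʳ _) (cong (suc q ∸_) (+-comm P 1))
  pathSum-legLabels P (suc (suc k)) (suc zero)    P+k≤q  =
    trans (cong (λ z → suc q ∸ z + (P + suc k)) (+-suc P (suc k)))
          (m∸n+n≡m (≤-trans (+-monoʳ-≤ P (n≤1+n (suc k))) P+k≤q))
  pathSum-legLabels P (suc k)       (suc (suc j)) P+k≤q  =
    pathSum-legLabels P k j (≤-trans (+-monoʳ-≤ P (n≤1+n k)) P+k≤q)

  sumAt : ℕ → ℕ → List ℕ → ℕ → ℕ
  sumAt s P ks = vsum' (legsEdges s (map double ks)) (spiderLabels P ks)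

  sumAt-first : ∀ s P k ks j → 0 < s → j < double k → P + k ≤ q → sumAt s P (k ∷ ks) (s + j) ≡ legSum P k j
  sumAt-first s P k ks j 0<s j<2k P+k≤q = begin
    sumAt s P (k ∷ ks) (s + j)
      ≡⟨ vsum-legsEdges-first s (double k) (map double ks) (spiderLabels P (k ∷ ks)) j 0<s j<2k ⟩
    pathSum (take (double k) (legLabels P k ++ spiderLabels (P + k) ks)) j
      ≡⟨ cong (λ ls → pathSum ls j) (take-++ (legLabels P k) _ (length-legLabels P k)) ⟩
    pathSum (legLabels P k) j
      ≡⟨ pathSum-legLabels P k j P+k≤q ⟩
    legSum P k j ∎
    where open ≡-Reasoning

  sumAt-later : ∀ s P k ks x → 0 < s → s + double k ≤ x →
    sumAt s P (k ∷ ks) x ≡ sumAt (s + double k) (P + k) ks x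
  sumAt-later s P k ks x 0<s s+2k≤x =
    trans (vsum-legsEdges-later s (double k) (map double ks) (spiderLabels P (k ∷ ks)) x 0<s s+2k≤x)
          (cong (λ ls → vsum' (legsEdges (s + double k) (map double ks)) ls x)
                (drop-++ (legLabels P k) _ (length-legLabels P k)))

  coreSum-spiderLabels : ∀ P ks → All (1 ≤_) ks →
    coreSum (map double ks) (spiderLabels P ks) ≡ length ks * P + weighted (length ks) ks
  coreSum-spiderLabels P []            _            = refl
  coreSum-spiderLabels P (suc k ∷ ks) (_ ∷ ks≥1) = begin
    P + suc k + coreSum (map double ks) (drop (double (suc k)) (spiderLabels P (suc k ∷ ks)))
      ≡⟨ cong (λ ls → P + suc k + coreSum (map double ks) ls) (drop-++ (legLabels P k) _ (length-legLabels P k)) ⟩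
    P + suc k + coreSum (map double ks) (spiderLabels (P + suc k) ks)
      ≡⟨ cong (P + suc k +_) (coreSum-spiderLabels (P + suc k) ks ks≥1) ⟩
    P + suc k + (length ks * (P + suc k) + weighted (length ks) ks)
      ≡⟨ regroup P (suc k) (length ks) (weighted (length ks) ks) ⟩
    suc (length ks) * P + (suc (length ks) * suc k + weighted (length ks) ks) ∎
    where
    open ≡-Reasoning
    regroup : ∀ P k L W → P + k + (L * (P + k) + W) ≡ suc L * P + (suc L * k + W)
    regroup = solve-∀

  sumAt-core : ∀ s P ks → 0 < s → All (1 ≤_) ks → sumAt s P ks 0 ≡ length ks * P + weighted (length ks) ks
  sumAt-core s P ks 0<s ks≥1 =
    trans (vsum-legsEdges-core s (map double ks) (spiderLabels P ks) 0<s)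
          (coreSum-spiderLabels P ks ks≥1)

  legSum-colour : ∀ P k j → j < double k → legSum P k j ∈ suc q ∷ q ∷ q ∸ P ∷ []
  legSum-colour P (suc k)       zero          _                 = here refl
  legSum-colour P (suc zero)    (suc zero)    _                 = there (there (here refl))
  legSum-colour P (suc (suc k)) (suc zero)    _                 = there (here refl)
  legSum-colour P (suc k)       (suc (suc j)) (s≤s (s≤s j<2k)) = legSum-colour P k j j<2k

  sumAt-colour : ∀ s P ks x → 0 < s → s ≤ x → x < s + sum (map double ks) → P + sum ks ≤ q →
    sumAt s P ks x ∈ suc q ∷ q ∷ map (q ∸_) (legOffsets P ks)
  sumAt-colour s P []       x _   s≤x x<s+0 _ = contradiction (subst (x <_) (+-identityʳ s) x<s+0) (≤⇒≯ s≤x)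
  sumAt-colour s P (k ∷ ks) x 0<s s≤x x<end P+Σ≤q with leg-or-beyond (double k) s≤x
  ... | inj₁ (j , j<2k , refl) =
    subst (_∈ _) (sym (sumAt-first s P k ks j 0<s j<2k P+k≤q)) (onFirstLeg (legSum-colour P k j j<2k))
    where
    P+k≤q : P + k ≤ q
    P+k≤q = ≤-trans (+-monoʳ-≤ P (m≤m+n k (sum ks))) P+Σ≤q
    onFirstLeg : suc q ∷ q ∷ q ∸ P ∷ [] ⊆ suc q ∷ q ∷ map (q ∸_) (legOffsets P (k ∷ ks))
    onFirstLeg (here refl)                = here refl
    onFirstLeg (there (here refl))        = there (here refl)
    onFirstLeg (there (there (here refl))) = there (there (here refl))
  ... | inj₂ s+2k≤x = subst (_∈ _) (sym (sumAt-later s P k ks x 0<s s+2k≤x)) (laterLegs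
          (sumAt-colour (s + double k) (P + k) ks x (<-≤-trans 0<s (m≤m+n s (double k))) s+2k≤x
                        (subst (x <_) (sym (+-assoc s (double k) _)) x<end)
                        (subst (_≤ q) (sym (+-assoc P k (sum ks))) P+Σ≤q)))
    where
    laterLegs : suc q ∷ q ∷ map (q ∸_) (legOffsets (P + k) ks) ⊆ suc q ∷ q ∷ map (q ∸_) (legOffsets P (k ∷ ks))
    laterLegs (here refl)         = here refl
    laterLegs (there (here refl)) = there (here refl)
    laterLegs (there (there c∈))  = there (there (there c∈))

  legSum-root : ∀ P k → 0 < double k → legSum P k 0 ≡ suc q
  legSum-root P (suc k) _ = refl

  legSum-adjacent : ∀ P k j → suc j < double k → legSum P k j ≢ legSum P k (suc j)
  legSum-adjacent P (suc zero)    zero          _                 = >⇒≢ (s≤s (m∸n≤m q P))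
  legSum-adjacent P (suc (suc k)) zero          _                 = >⇒≢ (n<1+n q)
  legSum-adjacent P (suc (suc k)) (suc zero)    _                 = <⇒≢ (n<1+n q)
  legSum-adjacent P (suc (suc k)) (suc (suc j)) (s≤s (s≤s 1+j<2k)) = legSum-adjacent P (suc k) j 1+j<2k
  legSum-adjacent P (suc zero)    (suc j)       (s≤s (s≤s ()))

  sumAt-legEdge : ∀ s P k ks {a b} → 0 < s → P + k ≤ q → (a , b) ∈ pathEdges 0 s (double k) →
      (a ≡ 0 × b ≡ s × sumAt s P (k ∷ ks) b ≡ suc q)
    ⊎ (s ≤ a × b ≡ suc a × sumAt s P (k ∷ ks) a ≢ sumAt s P (k ∷ ks) b)
  sumAt-legEdge s P k ks 0<s P+k≤q e∈ with pathEdges-∈ 0 s (double k) e∈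
  ... | inj₁ (refl , refl , 0<2k) = inj₁ (refl , refl , (begin
    sumAt s P (k ∷ ks) s        ≡⟨ cong (sumAt s P (k ∷ ks)) (+-identityʳ s) ⟨
    sumAt s P (k ∷ ks) (s + 0)  ≡⟨ sumAt-first s P k ks 0 0<s 0<2k P+k≤q ⟩
    legSum P k 0                ≡⟨ legSum-root P k 0<2k ⟩
    suc q                       ∎))
    where open ≡-Reasoning
  ... | inj₂ (j , 1+j<2k , refl , refl) = inj₂ (m≤m+n s j , refl , λ eq → legSum-adjacent P k j 1+j<2k (begin
    legSum P k j        ≡⟨ first j (<-trans (n<1+n j) 1+j<2k) ⟨
    F (s + j)           ≡⟨ eq ⟩
    F (suc (s + j))     ≡⟨ cong F (+-suc s j) ⟨
    F (s + suc j)       ≡⟨ first (suc j) 1+j<2k ⟩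
    legSum P k (suc j)  ∎))
    where
    open ≡-Reasoning
    F = sumAt s P (k ∷ ks)
    first : ∀ j → j < double k → F (s + j) ≡ legSum P k j
    first j j<2k = sumAt-first s P k ks j 0<s j<2k P+k≤q

  sumAt-edge : ∀ s P ks {a b} → 0 < s → P + sum ks ≤ q → (a , b) ∈ legsEdges s (map double ks) →
    (a ≡ 0 × s ≤ b × sumAt s P ks b ≡ suc q) ⊎ (s ≤ a × s ≤ b × sumAt s P ks a ≢ sumAt s P ks b)
  sumAt-edge s P (k ∷ ks) 0<s P+Σ≤q e∈ with ∈-++⁻ (pathEdges 0 s (double k)) e∈
  ... | inj₁ e∈leg with sumAt-legEdge s P k ks 0<s (≤-trans (+-monoʳ-≤ P (m≤m+n k (sum ks))) P+Σ≤q) e∈leg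
  ...   | inj₁ (a≡0 , refl , Fb≡) = inj₁ (a≡0 , ≤-refl , Fb≡)
  ...   | inj₂ (s≤a , refl , Fa≢Fb) = inj₂ (s≤a , m≤n⇒m≤1+n s≤a , Fa≢Fb)
  sumAt-edge s P (k ∷ ks) 0<s P+Σ≤q e∈ | inj₂ e∈rest
    with sumAt-edge (s + double k) (P + k) ks (<-≤-trans 0<s (m≤m+n s (double k)))
                    (subst (_≤ q) (sym (+-assoc P k (sum ks))) P+Σ≤q) e∈rest
  ... | inj₁ (a≡0 , s'≤b , Fb≡) =
    inj₁ (a≡0 , ≤-trans (m≤m+n s _) s'≤b , trans (sumAt-later s P k ks _ 0<s s'≤b) Fb≡)
  ... | inj₂ (s'≤a , s'≤b , Fa≢Fb) =
    inj₂ (≤-trans (m≤m+n s _) s'≤a , ≤-trans (m≤m+n s _) s'≤b ,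
          λ eq → Fa≢Fb (trans (sym (later s'≤a)) (trans eq (later s'≤b))))
    where
    later : ∀ {x} → s + double k ≤ x → sumAt s P (k ∷ ks) x ≡ sumAt (s + double k) (P + k) ks x
    later = sumAt-later s P k ks _ 0<s

  Mirrored : ℕ → ℕ → Set
  Mirrored z x = x ≡ z ⊎ x ≡ mirror z

  Q<mirror : ∀ {z} → z ≤ Q → Q < mirror z
  Q<mirror {z} z≤Q = begin-strict
    Q                        <⟨ n<1+n Q ⟩
    suc Q                    ≡⟨ m+n∸n≡m (suc Q) Q ⟨
    suc (Q + Q) ∸ Q          ≤⟨ ∸-monoʳ-≤ (suc (Q + Q)) z≤Q ⟩
    suc (Q + Q) ∸ z          ≡⟨ cong (λ n → suc n ∸ z) (double≡+ Q) ⟨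
    mirror z                 ∎
    where open ≤-Reasoning

  mirror-injective : ∀ {z z'} → z ≤ Q → z' ≤ Q → mirror z ≡ mirror z' → z ≡ z'
  mirror-injective z≤Q z'≤Q = ∸-cancelˡ-≡ (below z≤Q) (below z'≤Q)
    where
    below : ∀ {z} → z ≤ Q → z ≤ suc q
    below {z} z≤Q = ≤-trans (<⇒≤ (≤-<-trans z≤Q (Q<mirror z≤Q))) (m∸n≤m (suc q) z)

  mirrored-injective : ∀ {z z' x} → z ≤ Q → z' ≤ Q → Mirrored z x → Mirrored z' x → z ≡ z'
  mirrored-injective _   _    (inj₁ refl) (inj₁ x≡z') = x≡z'
  mirrored-injective z≤Q z'≤Q (inj₁ refl) (inj₂ x≡m)  =
    contradiction x≡m (<⇒≢ (≤-<-trans z≤Q (Q<mirror z'≤Q)))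
  mirrored-injective z≤Q z'≤Q (inj₂ refl) (inj₁ x≡z') =
    contradiction (sym x≡z') (<⇒≢ (≤-<-trans z'≤Q (Q<mirror z≤Q)))
  mirrored-injective z≤Q z'≤Q (inj₂ refl) (inj₂ x≡m)  = mirror-injective z≤Q z'≤Q x≡m

  legLabels-mirrored : ∀ P k {x} → x ∈ legLabels P k → ∃ λ z → P < z × z ≤ P + k × Mirrored z x
  legLabels-mirrored P (suc k) (here refl)         = P + suc k , m<m+n P (s≤s z≤n) , ≤-refl , inj₁ refl
  legLabels-mirrored P (suc k) (there (here refl)) = P + suc k , m<m+n P (s≤s z≤n) , ≤-refl , inj₂ refl
  legLabels-mirrored P (suc k) (there (there x∈)) with legLabels-mirrored P k x∈
  ... | z , P<z , z≤P+k , mz = z , P<z , ≤-trans z≤P+k (+-monoʳ-≤ P (n≤1+n k)) , mz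

  spiderLabels-mirrored : ∀ P ks {x} → x ∈ spiderLabels P ks → ∃ λ z → P < z × z ≤ P + sum ks × Mirrored z x
  spiderLabels-mirrored P (k ∷ ks) x∈ with ∈-++⁻ (legLabels P k) x∈
  ... | inj₁ x∈leg with legLabels-mirrored P k x∈leg
  ...   | z , P<z , z≤P+k , mz = z , P<z , ≤-trans z≤P+k (+-monoʳ-≤ P (m≤m+n k (sum ks))) , mz
  spiderLabels-mirrored P (k ∷ ks) x∈ | inj₂ x∈rest with spiderLabels-mirrored (P + k) ks x∈rest
  ... | z , P+k<z , z≤ , mz = z , ≤-<-trans (m≤m+n P k) P+k<z , subst (z ≤_) (+-assoc P k (sum ks)) z≤ , mz

  legLabels-unique : ∀ P k → P + k ≤ Q → Unique (legLabels P k)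
  legLabels-unique P zero    _      = []
  legLabels-unique P (suc k) P+k≤Q =
    (<⇒≢ (≤-<-trans P+k≤Q (Q<mirror P+k≤Q)) ∷ fresh (inj₁ refl)) ∷ fresh (inj₂ refl)
    ∷ legLabels-unique P k (≤-trans (+-monoʳ-≤ P (n≤1+n k)) P+k≤Q)
    where
    fresh : ∀ {x} → Mirrored (P + suc k) x → All (x ≢_) (legLabels P k)
    fresh mx = All.tabulate λ x'∈ x≡x' → case legLabels-mirrored P k x'∈ of λ where
      (z , _ , z≤P+k , mz) → <⇒≢ (≤-<-trans z≤P+k (+-monoʳ-< P (n<1+n k)))
        (mirrored-injective (≤-trans z≤P+k (≤-trans (+-monoʳ-≤ P (n≤1+n k)) P+k≤Q)) P+k≤Q
                            (subst (Mirrored z) (sym x≡x') mz) mx)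

  spiderLabels-unique : ∀ P ks → P + sum ks ≤ Q → Unique (spiderLabels P ks)
  spiderLabels-unique P []       _      = []
  spiderLabels-unique P (k ∷ ks) P+Σ≤Q =
    Unique.++⁺ (legLabels-unique P k P+k≤Q) (spiderLabels-unique (P + k) ks P+k+Σ≤Q) disjoint
    where
    P+k+Σ≤Q : P + k + sum ks ≤ Q
    P+k+Σ≤Q = subst (_≤ Q) (sym (+-assoc P k (sum ks))) P+Σ≤Q
    P+k≤Q : P + k ≤ Q
    P+k≤Q = m+n≤o⇒m≤o (P + k) P+k+Σ≤Q
    disjoint : ∀ {x} → ¬ (x ∈ legLabels P k × x ∈ spiderLabels (P + k) ks)
    disjoint (x∈leg , x∈rest) with legLabels-mirrored P k x∈leg | spiderLabels-mirrored (P + k) ks x∈rest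
    ... | z , _ , z≤P+k , mz | z' , P+k<z' , z'≤ , mz' =
      <⇒≢ (≤-<-trans z≤P+k P+k<z') (mirrored-injective (≤-trans z≤P+k P+k≤Q) (≤-trans z'≤ P+k+Σ≤Q) mz mz')

  ∈-1…q : ∀ {x} → 1 ≤ x → x ≤ q → x ∈ map suc (upTo q)
  ∈-1…q {suc x} _ x<q = ∈-map⁺ suc (∈-upTo⁺ x<q)

  spiderLabels-⊆ : ∀ ks → sum ks ≤ Q → spiderLabels 0 ks ⊆ map suc (upTo q)
  spiderLabels-⊆ ks Σ≤Q x∈ with spiderLabels-mirrored 0 ks x∈
  ... | z , 0<z , z≤Σ , inj₁ refl =
    ∈-1…q 0<z (≤-trans (≤-trans z≤Σ Σ≤Q) (subst (Q ≤_) (sym (double≡+ Q)) (m≤m+n Q Q)))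
  ... | suc z , _ , z≤Σ , inj₂ refl = ∈-1…q (≤-<-trans z≤n (Q<mirror (≤-trans z≤Σ Σ≤Q))) (m∸n≤m q z)

  length-spiderLabels : ∀ P ks → length (spiderLabels P ks) ≡ sum (map double ks)
  length-spiderLabels P []       = refl
  length-spiderLabels P (k ∷ ks) =
    trans (length-++ (legLabels P k)) (cong₂ _+_ (length-legLabels P k) (length-spiderLabels (P + k) ks))

  spiderLabels-↭ : ∀ ks → sum ks ≡ Q → spiderLabels 0 ks ↭ map suc (upTo q)
  spiderLabels-↭ ks Σ≡Q =
    unique-⊆⇒↭ (spiderLabels-unique 0 ks (≤-reflexive Σ≡Q)) (Unique.map⁺ suc-injective (Unique.upTo⁺ q))
               (spiderLabels-⊆ ks (≤-reflexive Σ≡Q)) (≤-reflexive length≡)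
    where
    length≡ : length (map suc (upTo q)) ≡ length (spiderLabels 0 ks)
    length≡ = begin
      length (map suc (upTo q))  ≡⟨ length-map suc (upTo q) ⟩
      length (upTo q)            ≡⟨ length-upTo q ⟩
      double Q                   ≡⟨ cong double Σ≡Q ⟨
      double (sum ks)            ≡⟨ sum-map-double ks ⟨
      sum (map double ks)        ≡⟨ length-spiderLabels 0 ks ⟨
      length (spiderLabels 0 ks) ∎
      where open ≡-Reasoning

spider-labelling : ∀ ks → All (1 ≤_) ks → ks ≢ [] → weighted (length ks) ks ≡ sum (map double ks) →
  Σ (List ℕ) λ labs → IsLocalAntimagic (spider (map double ks)) labs
                    × numColors (spider (map double ks)) labs ≤ suc (length ks)
spider-labelling []            _    []≢[] _     = contradiction refl []≢[]
spider-labelling ks@(_ ∷ _)    ks≥1 _     balanced = labs , (bijective , antimagic) , colours≤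
  where
  open Construction (sum ks)
  G = spider (map double ks)
  labs = spiderLabels 0 ks
  F = vsum G labs
  q≡ : sum (map double ks) ≡ q
  q≡ = sum-map-double ks
  Σ≤q : sum ks ≤ q
  Σ≤q = subst (sum ks ≤_) (sym (double≡+ (sum ks))) (m≤m+n (sum ks) (sum ks))
  bijective : IsBijLabeling G labs
  bijective = subst (λ n → labs ↭ map suc (upTo n)) (sym (trans (length-legsEdges 1 (map double ks)) q≡))
                    (spiderLabels-↭ ks refl)
  F0≡q : F 0 ≡ q
  F0≡q = begin
    F 0                                            ≡⟨ sumAt-core 1 0 ks (s≤s z≤n) ks≥1 ⟩
    length ks * 0 + weighted (length ks) ks        ≡⟨ cong (_+ weighted (length ks) ks) (*-zeroʳ (length ks)) ⟩
    weighted (length ks) ks                        ≡⟨ balanced ⟩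
    sum (map double ks)                            ≡⟨ q≡ ⟩
    q                                              ∎
    where open ≡-Reasoning
  edge-antimagic : ∀ {a b} → (a , b) ∈ edges G → F a ≢ F b
  edge-antimagic e∈ with sumAt-edge 1 0 ks (s≤s z≤n) Σ≤q e∈
  ... | inj₁ (refl , _ , Fb≡) = λ eq → <⇒≢ (n<1+n q) (trans (sym F0≡q) (trans eq Fb≡))
  ... | inj₂ (_ , _ , Fa≢Fb)  = Fa≢Fb
  antimagic : ∀ x y → x < n G → y < n G → Adjacent G x y → F x ≢ F y
  antimagic x y _ _ (inj₁ e∈) = edge-antimagic e∈
  antimagic x y _ _ (inj₂ e∈) = edge-antimagic e∈ ∘ sym
  C = suc q ∷ map (q ∸_) (legOffsets 0 ks)
  colours⊆C : deduplicate _≟_ (map F (upTo (n G))) ⊆ C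
  colours⊆C c∈ with ∈-map⁻ F (∈-deduplicate⁻ _≟_ _ c∈)
  ... | zero  , _  , refl = there (here F0≡q)
  ... | suc x , x∈ , refl with sumAt-colour 1 0 ks (suc x) (s≤s z≤n) (s≤s z≤n) (∈-upTo⁻ x∈) Σ≤q
  ...   | here c≡        = here c≡
  ...   | there (here c≡) = there (here c≡)
  ...   | there (there c∈) = there c∈
  |C|≡ : length C ≡ suc (length ks)
  |C|≡ = cong suc (trans (length-map (q ∸_) (legOffsets 0 ks)) (length-legOffsets 0 ks))
  colours≤ : numColors G labs ≤ suc (length ks)
  colours≤ = subst (numColors G labs ≤_) |C|≡ (unique-⊆⇒length≤ (deduplicate-! (map F (upTo (n G)))) colours⊆C)

double≡*2 : ∀ k → double k ≡ k * 2
double≡*2 zero    = refl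
double≡*2 (suc k) = cong (suc ∘ suc) (double≡*2 k)

double-injective : ∀ {m n} → double m ≡ double n → m ≡ n
double-injective {zero}  {zero}  _  = refl
double-injective {suc m} {suc n} eq = cong suc (double-injective (suc-injective (suc-injective eq)))

halves : ∀ ys → All (λ y → 2 ≤ y × 2 ∣ y) ys → ∃ λ ks → ys ≡ map double ks × All (1 ≤_) ks
halves []       []                            = [] , refl , []
halves (y ∷ ys) ((2≤y , divides k refl) ∷ ys-even) with halves ys ys-even
... | ks , refl , ks≥1 = k ∷ ks , cong (_∷ map double ks) (sym (double≡*2 k)) , positive k 2≤y ∷ ks≥1
  where
  positive : ∀ k → 2 ≤ k * 2 → 1 ≤ k
  positive (suc k) _ = s≤s z≤n

weighted-map-double : ∀ c ks → weighted c (map double ks) ≡ double (weighted c ks)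
weighted-map-double c []       = refl
weighted-map-double c (k ∷ ks) = begin
  c * double k + weighted (c ∸ 1) (map double ks)  ≡⟨ cong₂ (λ a b → c * a + b) (double≡+ k) (weighted-map-double (c ∸ 1) ks) ⟩
  c * (k + k) + double (weighted (c ∸ 1) ks)       ≡⟨ cong (c * (k + k) +_) (double≡+ _) ⟩
  c * (k + k) + (W + W)                            ≡⟨ distrib c k W ⟩
  (c * k + W) + (c * k + W)                        ≡⟨ double≡+ (c * k + W) ⟨
  double (c * k + W)                               ∎
  where
  open ≡-Reasoning
  W = weighted (c ∸ 1) ks
  distrib : ∀ c k W → c * (k + k) + (W + W) ≡ (c * k + W) + (c * k + W)
  distrib = solve-∀

weighted-∷ʳ : ∀ zs z →
  weighted (suc (length zs)) (zs ∷ʳ z) + z ≡ weighted (length zs ∸ 1) (zs ∷ʳ z) + double (sum (zs ∷ʳ z))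
weighted-∷ʳ []       z = trans (base z) (cong (0 * z +_) (sym (double≡+ (z + 0))))
  where
  base : ∀ z → 1 * z + 0 + z ≡ 0 * z + ((z + 0) + (z + 0))
  base = solve-∀
weighted-∷ʳ (k ∷ zs) z = begin
  suc (suc c) * k + weighted (suc c) (zs ∷ʳ z) + z   ≡⟨ +-assoc (suc (suc c) * k) _ z ⟩
  suc (suc c) * k + (weighted (suc c) (zs ∷ʳ z) + z) ≡⟨ cong (suc (suc c) * k +_) (weighted-∷ʳ zs z) ⟩
  suc (suc c) * k + (W + double S)                  ≡⟨ cong (λ d → suc (suc c) * k + (W + d)) (double≡+ S) ⟩
  suc (suc c) * k + (W + (S + S))                   ≡⟨ regroup c k W S ⟩
  c * k + W + ((k + S) + (k + S))                   ≡⟨ cong (c * k + W +_) (double≡+ (k + S)) ⟨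
  c * k + W + double (k + S)                        ∎
  where
  open ≡-Reasoning
  c = length zs
  W = weighted (c ∸ 1) (zs ∷ʳ z)
  S = sum (zs ∷ʳ z)
  regroup : ∀ c k W S → suc (suc c) * k + (W + (S + S)) ≡ c * k + W + ((k + S) + (k + S))
  regroup = solve-∀

balanced-halves : ∀ zs z ks → zs ∷ʳ z ≡ map double ks → z ≡ weighted (length zs ∸ 1) (zs ∷ʳ z) →
  weighted (length ks) ks ≡ sum (map double ks)
balanced-halves zs z ks ys≡ z≡ = double-injective (begin
  double (weighted (length ks) ks)            ≡⟨ cong (λ c → double (weighted c ks)) |ks|≡ ⟩
  double (weighted (suc c) ks)                ≡⟨ weighted-map-double (suc c) ks ⟨
  weighted (suc c) (map double ks)            ≡⟨ cong (weighted (suc c)) ys≡ ⟨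
  weighted (suc c) (zs ∷ʳ z)                  ≡⟨ +-cancelʳ-≡ z _ _ shifted ⟩
  double (sum (zs ∷ʳ z))                      ≡⟨ cong (double ∘ sum) ys≡ ⟩
  double (sum (map double ks))                ∎)
  where
  open ≡-Reasoning
  c = length zs
  |ks|≡ : length ks ≡ suc c
  |ks|≡ = trans (sym (length-map double ks)) (trans (cong length (sym ys≡)) (trans (length-++ zs) (+-comm c 1)))
  shifted : weighted (suc c) (zs ∷ʳ z) + z ≡ double (sum (zs ∷ʳ z)) + z
  shifted = trans (weighted-∷ʳ zs z) (trans (cong (_+ double (sum (zs ∷ʳ z))) (sym z≡)) (+-comm z _))

module _ {a} {A : Set a} where

  tabulate-∷ʳ : ∀ {m} (f : Fin (suc m) → A) → tabulate f ≡ tabulate (f ∘ inject₁) ∷ʳ f (fromℕ m)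
  tabulate-∷ʳ {zero}  f = refl
  tabulate-∷ʳ {suc m} f = cong (f Fin.zero ∷_) (tabulate-∷ʳ (f ∘ Fin.suc))

sum-tabulate-weights : ∀ {n} c (f : Fin n → ℕ) →
  sum (tabulate (λ i → (c ∸ toℕ i) * f i)) ≡ weighted c (tabulate f)
sum-tabulate-weights {zero}  c f = refl
sum-tabulate-weights {suc n} c f = cong (c * f Fin.zero +_) (begin
  sum (tabulate (λ i → (c ∸ suc (toℕ i)) * f (Fin.suc i)))  ≡⟨ cong sum (tabulate-cong shift) ⟨
  sum (tabulate (λ i → (c ∸ 1 ∸ toℕ i) * f (Fin.suc i)))    ≡⟨ sum-tabulate-weights (c ∸ 1) (f ∘ Fin.suc) ⟩
  weighted (c ∸ 1) (tabulate (f ∘ Fin.suc))                 ∎)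
  where
  open ≡-Reasoning
  shift : ∀ i → (c ∸ 1 ∸ toℕ i) * f (Fin.suc i) ≡ (c ∸ suc (toℕ i)) * f (Fin.suc i)
  shift i = cong (_* f (Fin.suc i)) (∸-+-assoc c 1 (toℕ i))

balanced-tabulate : ∀ m (y : Fin (suc m) → ℕ) ks → tabulate y ≡ map double ks →
  y (fromℕ m) ≡ sum (map (λ i → (suc m ∸ 2 ∸ toℕ i) * y i) (allFin (suc m))) →
  weighted (length ks) ks ≡ sum (map double ks)
balanced-tabulate m y ks ys≡ last≡ =
  balanced-halves zs (y (fromℕ m)) ks (trans (sym (tabulate-∷ʳ y)) ys≡) (begin
    y (fromℕ m)                                               ≡⟨ last≡ ⟩
    sum (map (λ i → (m ∸ 1 ∸ toℕ i) * y i) (allFin (suc m)))  ≡⟨ cong sum (map-tabulate id (λ i → (m ∸ 1 ∸ toℕ i) * y i)) ⟩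
    sum (tabulate (λ i → (m ∸ 1 ∸ toℕ i) * y i))              ≡⟨ sum-tabulate-weights (m ∸ 1) y ⟩
    weighted (m ∸ 1) (tabulate y)                             ≡⟨ cong₂ (λ c → weighted (c ∸ 1)) |zs|≡ (tabulate-∷ʳ y) ⟩
    weighted (length zs ∸ 1) (zs ∷ʳ y (fromℕ m))              ∎)
  where
  open ≡-Reasoning
  zs = tabulate (y ∘ inject₁)
  |zs|≡ : m ≡ length zs
  |zs|≡ = sym (length-tabulate (y ∘ inject₁))

χla-spider : ∀ ks → All (1 ≤_) ks → ks ≢ [] → weighted (length ks) ks ≡ sum (map double ks) →
  ChiLaIs (spider (map double ks)) (suc (length ks))
χla-spider []           _    []≢[] _        = contradiction refl []≢[]
χla-spider ks@(_ ∷ _) ks≥1 ks≢[] balanced with spider-labelling ks ks≥1 ks≢[] balanced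
... | labs , antimagic , colours≤ =
  (labs , antimagic , ≤-antisym colours≤ (lower labs (proj₁ antimagic))) , λ labs' (bij , _) → lower labs' bij
  where
  lower : ∀ labs → IsBijLabeling (spider (map double ks)) labs →
          suc (length ks) ≤ numColors (spider (map double ks)) labs
  lower labs bij = subst (λ d → suc d ≤ numColors (spider (map double ks)) labs) (length-map double ks)
    (spider-numColors≥ (map double ks) labs (All.map⁺ (All.map 2≤double ks≥1)) (λ ()) bij)
    where
    2≤double : ∀ {k} → 1 ≤ k → 2 ≤ double k
    2≤double {suc k} _ = s≤s (s≤s z≤n)

theorem2p9 : (m : ℕ) → 3 ≤ suc m → (y : Fin (suc m) → ℕ)
    → (∀ i → 2 ≤ y i × 2 ∣ y i)
    → y (fromℕ m) ≡ sum (map (λ i → (suc m ∸ 2 ∸ toℕ i) * y i) (allFin (suc m)))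
    → ChiLaIs (Spider (suc m) y) (suc m + 1)
theorem2p9 m _ y y-even last≡ with halves (tabulate y) (All.tabulate⁺ y-even)
... | []         , ()  , _
... | ks@(_ ∷ _) , ys≡ , ks≥1 =
  subst₂ (λ ys d → ChiLaIs (spider ys) d) (sym ys≡) d≡
         (χla-spider ks ks≥1 (λ ()) (balanced-tabulate m y ks ys≡ last≡))
  where
  d≡ : suc (length ks) ≡ suc m + 1
  d≡ = begin
    suc (length ks)               ≡⟨ cong suc (length-map double ks) ⟨
    suc (length (map double ks))  ≡⟨ cong (suc ∘ length) ys≡ ⟨
    suc (length (tabulate y))     ≡⟨ cong suc (length-tabulate y) ⟩
    suc (suc m)                   ≡⟨ +-comm 1 (suc m) ⟩
    suc m + 1                     ∎
    where open ≡-Reasoning
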